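{- Let $(\mathbf{A},r,k)$ be a yes-instance of \textsc{Low GF(2)-Rank Approximation}, where $\mathbf{A}$ is a binary $m\times n$ matrix with columns $\mathbf{a}^1,\ldots,\mathbf{a}^n$. Then there exist a positive integer $r'\le r$ and vectors $\mathbf{c}^1,\ldots,\mathbf{c}^{r'}\in\{0,1\}^m$, linearly independent over $\mathrm{GF}(2)$, each of which agrees with $\mathbf{A}$, such that $\sum_{i=1}^n\min\{d_H(\mathbf{s},\mathbf{a}^i)\mid \mathbf{s}=\bigoplus_{j\in I}\mathbf{c}^j,\ I\subseteq\{1,\ldots,r'\}\}\le k$.
   Context: $d_H$ denotes Hamming distance, $\bigoplus$ denotes summation over $\mathrm{GF}(2)$ (the empty sum is the zero vector). \textsc{Low GF(2)-Rank Approximation}: input a binary $m\times n$ matrix $\mathbf{A}$, positive integer $r$, nonnegative integer $k$; it is a yes-instance if there is a binary $m\times n$ matrix $\mathbf{B}$ of $\mathrm{GF}(2)$-rank at most $r$ differing from $\mathbf{A}$ in at most $k$ entries. If $\mathbf{A}$ has rows $\mathbf{a}_1,\ldots,\mathbf{a}_m$, a vector $\mathbf{c}=(c_1,\ldots,c_m)^\intercal$ agrees with $\mathbf{A}$ if $c_i=c_j$ whenever $\mathbf{a}_i=\mathbf{a}_j$. -}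

module Defs where

open import Data.Bool using (Bool; true; false; _xor_; if_then_else_)
open import Data.Nat using (ℕ; zero; suc; _+_; _≤_; _⊓_)
open import Data.Fin using (Fin; zero; suc)
open import Data.Product using (Σ; _×_; ∃)
open import Relation.Binary.PropositionalEquality using (_≡_)

-- Binary vectors of length m and binary m×n matrices (entries in GF(2) = Bool,
-- addition = xor).
BVec : ℕ → Set
BVec m = Fin m → Bool

BMat : ℕ → ℕ → Set
BMat m n = Fin m → Fin n → Bool

zeroVec : ∀ {m} → BVec m
zeroVec _ = false

_⊕_ : ∀ {m} → BVec m → BVec m → BVec m
(u ⊕ v) i = u i xor v i

col : ∀ {m n} → BMat m n → Fin n → BVec m
col B j i = B i j

sumFin : ∀ {t} → (Fin t → ℕ) → ℕ
sumFin {zero}  f = 0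
sumFin {suc t} f = f zero + sumFin (λ i → f (suc i))

dH : ∀ {m} → BVec m → BVec m → ℕ
dH u v = sumFin (λ i → if u i xor v i then 1 else 0)

dHMat : ∀ {m n} → BMat m n → BMat m n → ℕ
dHMat A B = sumFin (λ i → dH (A i) (B i))

Subset : ℕ → Set
Subset t = Fin t → Bool

bigXor : ∀ {t m} → Subset t → (Fin t → BVec m) → BVec m
bigXor {zero}  I c = zeroVec
bigXor {suc t} I c =
  (if I zero then c zero else zeroVec) ⊕ bigXor (λ j → I (suc j)) (λ j → c (suc j))

IsEmpty : ∀ {t} → Subset t → Set
IsEmpty I = ∀ j → I j ≡ false

LinIndep : ∀ {t m} → (Fin t → BVec m) → Set
LinIndep c = ∀ I → (∀ i → bigXor I c i ≡ false) → IsEmpty I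

-- GF(2)-rank of B is at most r: every linearly independent family of
-- columns of B has at most r members (rank = max number of lin. indep. columns)
RankAtMost : ∀ {m n} → BMat m n → ℕ → Set
RankAtMost {m} {n} B r =
  ∀ (t : ℕ) (σ : Fin t → Fin n) → LinIndep (λ j → col B (σ j)) → t ≤ r

YesInstance : ∀ {m n} → BMat m n → ℕ → ℕ → Set
YesInstance {m} {n} A r k = Σ (BMat m n) λ B → RankAtMost B r × dHMat A B ≤ k

Agrees : ∀ {m n} → BMat m n → BVec m → Set
Agrees {m} {n} A c = ∀ (i j : Fin m) → (∀ l → A i l ≡ A j l) → c i ≡ c j

minSub : (t : ℕ) → (Subset t → ℕ) → ℕ
minSub zero    f = f (λ ())
minSub (suc t) f =
  minSub t (λ I → f (λ { zero → false ; (suc j) → I j }))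
  ⊓ minSub t (λ I → f (λ { zero → true ; (suc j) → I j }))

-- Replace every row of an optimal approximation B by the row of B nearest to the corresponding
-- row of A. The new matrix B' is no farther from A, its rows are rows of B (so its rank is at most
-- that of B), and identical rows of A receive identical rows, so every column of B' agrees with A.
-- A basis extracted from the columns of B' then consists of agreeing, independent vectors whose
-- span contains every column of B', and choosing for column i of A the subset producing column i
-- of B' shows that the minimum-distance cost is at most d_H(A, B') ≤ k. If B' = 0 the basis is
-- empty and the all-ones vector, which agrees with every matrix, serves instead.
module Submission where

open import Defs
open import Data.Nat using (ℕ; _≤_)
open import Data.Fin using (Fin)
open import Data.Product using (Σ; _×_)

open import Algebra.Properties.CommutativeSemigroup using (interchange)
open import Data.Bool using (Bool; true; false; _xor_; if_then_else_)
open import Data.Bool.Properties using (xor-comm; xor-identityʳ) renaming (_≟_ to _≟ᵇ_)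
open import Data.Empty using (⊥-elim)
open import Data.Fin using (zero; suc)
open import Data.Fin.Properties using (all?)
open import Data.Fin.Subset.Properties using (anySubset?)
open import Data.List using (allFin)
open import Data.List.Extrema.Nat using (argmin; f[argmin]≤f[xs])
open import Data.List.Membership.Propositional.Properties using (∈-allFin)
open import Data.List.Relation.Unary.All as All using ()
open import Data.Nat using (zero; suc; _+_; z≤n; s≤s)
open import Data.Nat.Properties using (+-mono-≤; +-commutativeSemigroup; ≤-refl; ≤-trans; ≤-reflexive; m⊓n≤m; m⊓n≤n)
open import Data.Product using (_,_)
open import Data.Vec using (Vec; lookup; tabulate)
open import Data.Vec.Functional using (_∷_)
open import Data.Vec.Properties using (lookup∘tabulate; tabulate-cong)
open import Relation.Binary.PropositionalEquality
open import Relation.Nullary using (Dec; yes; no; ¬_)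
open import Relation.Nullary.Decidable using (map′)

sumFin-cong : ∀ {t} {f g : Fin t → ℕ} → (∀ i → f i ≡ g i) → sumFin f ≡ sumFin g
sumFin-cong {zero}  f≗g = refl
sumFin-cong {suc t} f≗g = cong₂ _+_ (f≗g zero) (sumFin-cong (λ i → f≗g (suc i)))

sumFin-mono : ∀ {t} {f g : Fin t → ℕ} → (∀ i → f i ≤ g i) → sumFin f ≤ sumFin g
sumFin-mono {zero}  f≤g = z≤n
sumFin-mono {suc t} f≤g = +-mono-≤ (f≤g zero) (sumFin-mono (λ i → f≤g (suc i)))

sumFin-0 : ∀ t → sumFin {t} (λ _ → 0) ≡ 0
sumFin-0 zero    = refl
sumFin-0 (suc t) = sumFin-0 t

sumFin-+ : ∀ {t} (f g : Fin t → ℕ) → sumFin (λ i → f i + g i) ≡ sumFin f + sumFin g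
sumFin-+ {zero}  f g = refl
sumFin-+ {suc t} f g =
  trans (cong (f zero + g zero +_) (sumFin-+ (λ i → f (suc i)) (λ i → g (suc i))))
        (interchange +-commutativeSemigroup (f zero) (g zero) _ _)

sumFin-swap : ∀ {a b} (f : Fin a → Fin b → ℕ) →
  sumFin (λ i → sumFin (λ j → f i j)) ≡ sumFin (λ j → sumFin (λ i → f i j))
sumFin-swap {zero}  {b} f = sym (sumFin-0 b)
sumFin-swap {suc a} f =
  trans (cong (sumFin (f zero) +_) (sumFin-swap (λ i → f (suc i))))
        (sym (sumFin-+ (f zero) (λ j → sumFin (λ i → f (suc i) j))))

dH-cong : ∀ {m} {u u' v v' : BVec m} → (∀ i → u i ≡ u' i) → (∀ i → v i ≡ v' i) → dH u v ≡ dH u' v'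
dH-cong u≗u' v≗v' = sumFin-cong (λ i → cong₂ (λ x y → if x xor y then 1 else 0) (u≗u' i) (v≗v' i))

dH-comm : ∀ {m} (u v : BVec m) → dH u v ≡ dH v u
dH-comm u v = sumFin-cong (λ i → cong (λ x → if x then 1 else 0) (xor-comm (u i) (v i)))

dHMat-byColumns : ∀ {m n} (A B : BMat m n) → dHMat A B ≡ sumFin (λ l → dH (col A l) (col B l))
dHMat-byColumns A B = sumFin-swap (λ i l → if A i l xor B i l then 1 else 0)

bigXor-cong : ∀ {t m} {I J : Subset t} (c : Fin t → BVec m) → (∀ j → I j ≡ J j) →
  ∀ i → bigXor I c i ≡ bigXor J c i
bigXor-cong {zero}  c I≗J i = refl
bigXor-cong {suc t} c I≗J i =
  cong₂ (λ b x → (if b then c zero else zeroVec) i xor x)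
        (I≗J zero) (bigXor-cong (λ j → c (suc j)) (λ j → I≗J (suc j)) i)

bigXor-∘ : ∀ {t m m'} (I : Subset t) (c : Fin t → BVec m) (p : Fin m' → Fin m) →
  ∀ i → bigXor I (λ j i' → c j (p i')) i ≡ bigXor I c (p i)
bigXor-∘ {zero}  I c p i = refl
bigXor-∘ {suc t} I c p i with I zero
... | true  = cong (c zero (p i) xor_) (bigXor-∘ (λ j → I (suc j)) (λ j → c (suc j)) p i)
... | false = bigXor-∘ (λ j → I (suc j)) (λ j → c (suc j)) p i

bigXor-∅ : ∀ {t m} (c : Fin t → BVec m) i → bigXor (λ _ → false) c i ≡ false
bigXor-∅ {zero}  c i = refl
bigXor-∅ {suc t} c i = bigXor-∅ (λ j → c (suc j)) i

-- `minSub` rebuilds subsets as pattern lambdas, which agree with a given subset only pointwise.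
minSub≤ : ∀ t (f : Subset t → ℕ) → (∀ {I J} → (∀ j → I j ≡ J j) → f I ≡ f J) →
  ∀ I → minSub t f ≤ f I
minSub≤ zero    f f-cong I = ≤-reflexive (f-cong (λ ()))
minSub≤ (suc t) f f-cong I = by-first (I zero) refl
  where
  restrict : (g : Subset t → Subset (suc t)) → (∀ K → g K zero ≡ I zero) → (∀ K j → g K (suc j) ≡ K j) →
    minSub t (λ K → f (g K)) ≤ f I
  restrict g g₀ gₛ =
    ≤-trans (minSub≤ t (λ K → f (g K))
                     (λ K≗L → f-cong (λ { zero → trans (g₀ _) (sym (g₀ _))
                                        ; (suc j) → trans (gₛ _ j) (trans (K≗L j) (sym (gₛ _ j))) }))
                     (λ j → I (suc j)))
            (≤-reflexive (f-cong (λ { zero → g₀ _ ; (suc j) → gₛ _ j })))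
  by-first : ∀ b → b ≡ I zero → minSub (suc t) f ≤ f I
  by-first false e = ≤-trans (m⊓n≤m _ _) (restrict _ (λ _ → e) (λ _ _ → refl))
  by-first true  e = ≤-trans (m⊓n≤n _ _) (restrict _ (λ _ → e) (λ _ _ → refl))

InSpan : ∀ {t m} → (Fin t → BVec m) → BVec m → Set
InSpan {t} c w = Σ (Subset t) λ I → ∀ i → bigXor I c i ≡ w i

inSpan? : ∀ {t m} (c : Fin t → BVec m) (w : BVec m) → Dec (InSpan c w)
inSpan? c w = map′ (λ (v , v-sums) → lookup v , v-sums)
                   (λ (I , I-sums) → tabulate I , λ i → trans (bigXor-cong c (lookup∘tabulate I) i) (I-sums i))
                   (anySubset? (λ v → all? (λ i → bigXor (lookup v) c i ≟ᵇ w i)))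

InSpan-∷ʳ : ∀ {t m} {c : Fin t → BVec m} {u : BVec m} (w : BVec m) → InSpan c u → InSpan (w ∷ c) u
InSpan-∷ʳ w (I , I-sums) = false ∷ I , I-sums

InSpan-∷ˡ : ∀ {t m} (w : BVec m) (c : Fin t → BVec m) → InSpan (w ∷ c) w
InSpan-∷ˡ w c = true ∷ (λ _ → false) , λ i → trans (cong (w i xor_) (bigXor-∅ c i)) (xor-identityʳ (w i))

InSpan-[] : ∀ {t m} {w : BVec m} (c : Fin 0 → BVec m) (d : Fin t → BVec m) → InSpan c w → InSpan d w
InSpan-[] _ d (_ , ∅-sums) = (λ _ → false) , λ i → trans (bigXor-∅ d i) (∅-sums i)

xor≡false⇒≡ : ∀ a b → a xor b ≡ false → b ≡ a
xor≡false⇒≡ false b e = e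
xor≡false⇒≡ true false ()
xor≡false⇒≡ true true  e = refl

LinIndep-∷ : ∀ {t m} (w : BVec m) (c : Fin t → BVec m) → LinIndep c → ¬ InSpan c w → LinIndep (w ∷ c)
LinIndep-∷ w c c-indep w∉c I I-sums with I zero in I₀
... | true  = ⊥-elim (w∉c ((λ j → I (suc j)) , λ i → xor≡false⇒≡ (w i) _ (I-sums i)))
... | false = λ { zero → I₀ ; (suc j) → c-indep (λ j → I (suc j)) I-sums j }

LinIndep-singleton : ∀ {m} (w : BVec m) (i : Fin m) → w i ≡ true → LinIndep (λ (_ : Fin 1) → w)
LinIndep-singleton w i wᵢ I I-sums with I zero in I₀
... | false = λ { zero → I₀ }
... | true with trans (sym wᵢ) (trans (sym (xor-identityʳ (w i))) (I-sums i))
...   | ()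

record Basis {m n} (v : Fin n → BVec m) : Set where
  field
    size        : ℕ
    index       : Fin size → Fin n
    independent : LinIndep (λ j → v (index j))
    spanning    : ∀ l → InSpan (λ j → v (index j)) (v l)

basis : ∀ {m n} (v : Fin n → BVec m) → Basis v
basis {n = zero}  v = record { size = 0 ; index = λ () ; independent = λ _ _ () ; spanning = λ () }
basis {n = suc n} v with basis (λ l → v (suc l))
... | record { size = t ; index = σ ; independent = σ-indep ; spanning = σ-spans }
  with inSpan? (λ j → v (suc (σ j))) (v zero)
... | yes v₀∈σ = record { size = t ; index = λ j → suc (σ j) ; independent = σ-indep
                        ; spanning = λ { zero → v₀∈σ ; (suc l) → σ-spans l } }
... | no  v₀∉σ = record { size = suc t ; index = zero ∷ (λ j → suc (σ j))
                        ; independent = LinIndep-∷ (v zero) _ σ-indep v₀∉σ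
                        ; spanning = λ { zero → InSpan-∷ˡ (v zero) _
                                       ; (suc l) → InSpan-∷ʳ (v zero) (σ-spans l) } }

-- The row is passed as a `Vec` so that pointwise equal rows give propositionally equal arguments;
-- the block is opaque to keep conversion checking from unfolding `argmin`.
opaque
  nearestRow : ∀ {m n} → BMat (suc m) n → Vec Bool n → Fin (suc m)
  nearestRow B a = argmin (λ j → dH (lookup a) (B j)) zero (allFin _)

  nearestRow-≤ : ∀ {m n} (B : BMat (suc m) n) (a : Vec Bool n) j →
    dH (lookup a) (B (nearestRow B a)) ≤ dH (lookup a) (B j)
  nearestRow-≤ B a j = All.lookup (f[argmin]≤f[xs] {f = λ j' → dH (lookup a) (B j')} zero (allFin _)) (∈-allFin j)

snap : ∀ {m m' n} → BMat m n → BMat (suc m') n → BMat m n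
snap A B i = B (nearestRow B (tabulate (A i)))

snap-agrees : ∀ {m m' n} (A : BMat m n) (B : BMat (suc m') n) l → Agrees A (col (snap A B) l)
snap-agrees A B l i j Aᵢ≗Aⱼ = cong (λ a → B (nearestRow B a) l) (tabulate-cong Aᵢ≗Aⱼ)

dHMat-snap≤ : ∀ {m n} (A B : BMat (suc m) n) → dHMat A (snap A B) ≤ dHMat A B
dHMat-snap≤ A B = sumFin-mono λ i →
  subst₂ _≤_ (Aᵢ≡ (B (nearestRow B (tabulate (A i))))) (Aᵢ≡ (B i)) (nearestRow-≤ B (tabulate (A i)) i)
  where
  Aᵢ≡ : ∀ {i} (u : BVec _) → dH (lookup (tabulate (A i))) u ≡ dH (A i) u
  Aᵢ≡ {i} u = dH-cong (lookup∘tabulate (A i)) (λ _ → refl)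

RankAtMost-∘ : ∀ {m m' n} {B : BMat m n} {r} (p : Fin m' → Fin m) → RankAtMost B r → RankAtMost (λ i → B (p i)) r
RankAtMost-∘ {B = B} p rank≤r t σ σ-indep =
  rank≤r t σ λ I I-sums → σ-indep I λ i → trans (bigXor-∘ I (λ j → col B (σ j)) p i) (I-sums (p i))

spanning-cost≤ : ∀ {m n t} (A B : BMat m n) (c : Fin t → BVec m) → (∀ l → InSpan c (col B l)) →
  sumFin (λ l → minSub t (λ I → dH (bigXor I c) (col A l))) ≤ dHMat A B
spanning-cost≤ {t = t} A B c c-spans =
  ≤-trans (sumFin-mono column≤)
          (≤-reflexive (sym (trans (dHMat-byColumns A B) (sumFin-cong λ l → dH-comm (col A l) (col B l)))))
  where
  column≤ : ∀ l → minSub t (λ I → dH (bigXor I c) (col A l)) ≤ dH (col B l) (col A l)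
  column≤ l with c-spans l
  ... | I , I-sums = ≤-trans (minSub≤ t _ (λ I≗J → dH-cong (bigXor-cong c I≗J) (λ _ → refl)) I)
                             (≤-reflexive (dH-cong I-sums (λ _ → refl)))

-- The all-ones vector replaces an empty family: it is nonzero because m ≥ 1 and agrees with every matrix.
solution-from-family : ∀ {m n} (A B : BMat m n) {r k} → Fin m → 1 ≤ r → dHMat A B ≤ k →
  ∀ t → t ≤ r → (c : Fin t → BVec m) → LinIndep c → (∀ j → Agrees A (c j)) → (∀ l → InSpan c (col B l)) →
  Σ ℕ λ r' → 1 ≤ r' × r' ≤ r ×
    Σ (Fin r' → BVec m) λ c' → LinIndep c' × (∀ j → Agrees A (c' j)) ×
      sumFin (λ l → minSub r' (λ I → dH (bigXor I c') (col A l))) ≤ k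
solution-from-family A B i 1≤r dist≤k zero _ c _ _ c-spans =
  1 , ≤-refl , 1≤r , allOnes , LinIndep-singleton (λ _ → true) i refl , (λ _ _ _ _ → refl) ,
  ≤-trans (spanning-cost≤ A B allOnes (λ l → InSpan-[] c allOnes (c-spans l))) dist≤k
  where
  allOnes : Fin 1 → BVec _
  allOnes _ _ = true
solution-from-family A B _ _ dist≤k (suc t) t≤r c c-indep c-agrees c-spans =
  suc t , s≤s z≤n , t≤r , c , c-indep , c-agrees , ≤-trans (spanning-cost≤ A B c c-spans) dist≤k

lemma7 : ∀ {m n : ℕ} (A : BMat m n) (r k : ℕ) →
    1 ≤ m → 1 ≤ r → YesInstance A r k →
    Σ ℕ λ r' → 1 ≤ r' × r' ≤ r ×
    Σ (Fin r' → BVec m) λ c →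
    LinIndep c × (∀ j → Agrees A (c j)) ×
    sumFin (λ i → minSub r' (λ I → dH (bigXor I c) (col A i))) ≤ k
lemma7 {zero}  A r k () _ _
lemma7 {suc m} A r k _ 1≤r (B , rank≤r , dist≤k) =
  solution-from-family A B' zero 1≤r (≤-trans (dHMat-snap≤ A B) dist≤k)
    size size≤r (λ j → col B' (index j)) independent (λ j → snap-agrees A B (index j)) spanning
  where
  B' : BMat (suc m) _
  B' = snap A B
  open Basis (basis (col B'))
  size≤r : size ≤ r
  size≤r = RankAtMost-∘ {B = B} (λ i → nearestRow B (tabulate (A i))) rank≤r size index independent
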